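{- Let $k\geq 2$ and $b$ be integers with $k^2<b\leq k^2+k$. Let $1/k=0.c_1c_2c_3\dots$ be the non-terminating base-$b$ expansion of $1/k$, and let $l\geq 1$ be an integer such that the digit sequence $c_{l+1},c_{l+2},\dots$ is purely periodic. Define $$j:=\left\lfloor \sum_{i=1}^l c_i b^{l-i}+\frac{k}{b-k^2}-\frac{b^l-1}{k}+1\right\rfloor.$$ Then $1\leq j\leq k+1$. Moreover, $j=k+1$ if and only if $b=k^2+1$.
   Context: The non-terminating base-$b$ expansion of a number is the expansion that does not end in an infinite string of zeros. -}

module Defs where

open import Data.Nat using (ℕ; zero; suc; _+_; _*_; _∸_; _^_; _≤_; _<_)
open import Data.Integer using (ℤ; +_)
open import Data.Rational using (ℚ; floor; _/_) renaming (_+_ to _+ℚ_; _-_ to _-ℚ_)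
open import Data.Product using (_×_; ∃)
open import Relation.Binary.PropositionalEquality using (_≡_)

-- Digit sequences are functions c : ℕ → ℕ, read as c 1, c 2, c 3, …
-- (the value at 0 is irrelevant).

prefixValue : ℕ → (ℕ → ℕ) → ℕ → ℕ
prefixValue b c zero    = 0
prefixValue b c (suc n) = prefixValue b c n * b + c (suc n)

-- c is the non-terminating base-b expansion of 1/k, i.e.
-- 1/k = Σ_{i≥1} c_i b^{-i} with digits in {0,…,b-1} and not ending in
-- an infinite string of zeros.  Equivalently (exact, finitary form):
-- for every n, the tail Σ_{i>n} c_i b^{-i} = 1/k - r_n/b^n lies in (0, b^{-n}],
-- where r_n = prefixValue b c n; i.e.  k r_n < b^n ≤ k r_n + k.
IsNonTermExpansion : (b k : ℕ) → (ℕ → ℕ) → Set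
IsNonTermExpansion b k c =
  (∀ i → c i < b) ×
  (∀ n → (k * prefixValue b c n < b ^ n) × (b ^ n ≤ k * prefixValue b c n + k))

PurelyPeriodicFrom : ℕ → (ℕ → ℕ) → Set
PurelyPeriodicFrom l c = ∃ λ p → (1 ≤ p) × (∀ i → l + 1 ≤ i → c (i + p) ≡ c i)

-- n / d as a rational; the d = 0 case is a dummy value never used
-- under the theorem's hypotheses (d ∈ {k, b - k²} are both ≥ 1 there).
divℚ : ℕ → ℕ → ℚ
divℚ n zero    = + 0 / 1
divℚ n (suc d) = + n / suc d

jValue : (k b l : ℕ) → (ℕ → ℕ) → ℤ
jValue k b l c =
  floor (((+ prefixValue b c l / 1) +ℚ divℚ k (b ∸ k * k))
          -ℚ divℚ (b ^ l ∸ 1) k +ℚ (+ 1 / 1))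

-- Write d = b − k², so 1 ≤ d ≤ k, and let r be the integer formed by the first l digits.
-- The expansion bounds at position l say exactly that b^l − 1 = k r + s with 0 ≤ s < k.
-- The integer parts then cancel: with t = k − s,
--   j = ⌊1 + k/d − s/k⌋ = ⌊(k² + d t)/(k d)⌋.
-- The numerator lies between k d and (k + 1) k d, and stays below (k + 1) k d unless d = 1;
-- conversely, if b = k² + 1 then b^l ≡ 1 (mod k) forces s = 0, i.e. t = k, and j = k + 1.
module Submission where

open import Defs
open import Data.Nat using (ℕ; zero; suc; _+_; _*_; _∸_; _^_; _≤_; _<_; NonZero; >-nonZero; >-nonZero⁻¹; z≤n; s≤s)
open import Data.Nat.Properties
open import Data.Nat.DivMod using (_/_; /-congˡ; /-congʳ; /-monoˡ-≤; m*n/o*n≡m/o; m*n/n≡m; m<n*o⇒m/o<n; m≥n⇒m/n>0)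
open import Data.Nat.Divisibility using (_∣_; _∣0; ∣m∣n⇒∣m+n; ∣m+n∣m⇒∣n; ∣m⇒∣m*n; m∣m*n; >⇒∤)
open import Data.Integer as ℤ using (ℤ; +_; -[1+_]) renaming (_≤_ to _≤ℤ_)
import Data.Integer.Properties as ℤ
open import Data.Integer.DivMod using (div-pos-is-/ℕ)
open import Data.Integer.Tactic.RingSolver using (solve-∀)
open import Data.Nat.Tactic.RingSolver renaming (solve-∀ to solve-ℕ)
open import Data.Rational as ℚ using (mkℚ; floor; toℚᵘ)
import Data.Rational.Properties as ℚ
open import Data.Rational.Unnormalised as ℚᵘ using (mkℚᵘ; *≡*; 1ℚᵘ; _≃_)
import Data.Rational.Unnormalised.Properties as ℚᵘ
open import Data.Product using (_×_; _,_; proj₁; proj₂; ∃-syntax)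
open import Function.Bundles using (_⇔_; mk⇔)
open import Relation.Binary.PropositionalEquality
open import Relation.Nullary using (contradiction)

m*q≡n*p⇒m/p≡n/q : ∀ {m n p q} .{{_ : NonZero p}} .{{_ : NonZero q}} →
                  m * q ≡ n * p → m / p ≡ n / q
m*q≡n*p⇒m/p≡n/q {m} {n} {p} {q} eq = begin
  m / p                ≡⟨ m*n/o*n≡m/o m q p ⟨
  m * q / (p * q)      ≡⟨ /-congˡ eq ⟩
  n * p / (p * q)      ≡⟨ /-congʳ (*-comm p q) ⟩
  n * p / (q * p)      ≡⟨ m*n/o*n≡m/o n p q ⟩
  n / q                ∎
  where
  open ≡-Reasoning
  instance
    _ = m*n≢0 p q
    _ = m*n≢0 q p

floor-≃-/ : ∀ q n m .{{_ : NonZero m}} → toℚᵘ q ≃ + n ℚᵘ./ m → floor q ≡ + (n / m)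
floor-≃-/ (mkℚ (+ a) e _) n m@(suc _) (*≡* eq) =
  trans (div-pos-is-/ℕ (+ a) (suc e))
        (cong +_ (m*q≡n*p⇒m/p≡n/q {a} {n} (ℤ.+-injective (trans (ℤ.pos-* a m) (trans eq (sym (ℤ.pos-* n (suc e))))))))
floor-≃-/ (mkℚ -[1+ a ] e _) n (suc _) (*≡* eq) with trans eq (sym (ℤ.pos-* n (suc e)))
... | ()

toℚᵘ-/ : ∀ i n .{{_ : NonZero n}} → toℚᵘ (i ℚ./ n) ≃ i ℚᵘ./ n
toℚᵘ-/ i (suc n) = ℚ.toℚᵘ-fromℚᵘ (mkℚᵘ i n)

divℚ≡/ : ∀ n d .{{_ : NonZero d}} → divℚ n d ≡ + n ℚ./ d
divℚ≡/ n (suc d) = refl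

toℚᵘ-homo-[p+q-r]+s : ∀ p q r s →
  toℚᵘ (((p ℚ.+ q) ℚ.- r) ℚ.+ s) ≃ ((toℚᵘ p ℚᵘ.+ toℚᵘ q) ℚᵘ.- toℚᵘ r) ℚᵘ.+ toℚᵘ s
toℚᵘ-homo-[p+q-r]+s p q r s = begin
  toℚᵘ (((p ℚ.+ q) ℚ.- r) ℚ.+ s)                           ≈⟨ ℚ.toℚᵘ-homo-+ ((p ℚ.+ q) ℚ.- r) s ⟩
  toℚᵘ ((p ℚ.+ q) ℚ.- r) ℚᵘ.+ toℚᵘ s                       ≈⟨ ℚᵘ.+-congˡ (toℚᵘ s) (ℚ.toℚᵘ-homo-+ (p ℚ.+ q) (ℚ.- r)) ⟩
  (toℚᵘ (p ℚ.+ q) ℚᵘ.+ toℚᵘ (ℚ.- r)) ℚᵘ.+ toℚᵘ s           ≈⟨ ℚᵘ.+-congˡ (toℚᵘ s) (ℚᵘ.+-cong (ℚ.toℚᵘ-homo-+ p q) (ℚ.toℚᵘ-homo‿- r)) ⟩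
  ((toℚᵘ p ℚᵘ.+ toℚᵘ q) ℚᵘ.- toℚᵘ r) ℚᵘ.+ toℚᵘ s           ∎
  where open ℚᵘ.≃-Reasoning

R+k/d-[kR+S]/k+1≃[kk+dT]/kd : ∀ (R S T : ℤ) k d .{{_ : NonZero k}} .{{_ : NonZero d}} → + k ≡ S ℤ.+ T →
  ((R ℚᵘ./ 1 ℚᵘ.+ + k ℚᵘ./ d) ℚᵘ.- (+ k ℤ.* R ℤ.+ S) ℚᵘ./ k) ℚᵘ.+ 1ℚᵘ
    ≃ ℚᵘ._/_ (+ k ℤ.* + k ℤ.+ + d ℤ.* T) (k * d) {{m*n≢0 k d}}
R+k/d-[kR+S]/k+1≃[kk+dT]/kd R S T k@(suc _) d@(suc _) k≡S+T = *≡* (cross-multiplied R S T (+ k) (+ d) _ _ _ k≡S+T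
  (cong +_ (*-identityˡ d)) (trans (cong (λ x → + (x * k)) (*-identityˡ d)) (ℤ.pos-* d k)) (ℤ.pos-* k d))
  where
  -- D′, DK′ and KD′ stand for the denominators + (1 * d), + (1 * d * k) and + (k * d) that unfolding ℚᵘ arithmetic leaves behind.
  cross-multiplied : ∀ R S T K D D′ DK′ KD′ → K ≡ S ℤ.+ T → D′ ≡ D → DK′ ≡ D ℤ.* K → KD′ ≡ K ℤ.* D →
    (((R ℤ.* D ℤ.+ K ℤ.* + 1) ℤ.* K ℤ.+ ℤ.- (K ℤ.* R ℤ.+ S) ℤ.* D′) ℤ.* + 1 ℤ.+ + 1 ℤ.* DK′) ℤ.* KD′
      ≡ (K ℤ.* K ℤ.+ D ℤ.* T) ℤ.* (DK′ ℤ.* + 1)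
  cross-multiplied R S T _ D _ _ _ refl refl refl refl = polynomial-identity R S T D
    where
    polynomial-identity : ∀ R S T D →
      (((R ℤ.* D ℤ.+ (S ℤ.+ T) ℤ.* + 1) ℤ.* (S ℤ.+ T) ℤ.+ ℤ.- ((S ℤ.+ T) ℤ.* R ℤ.+ S) ℤ.* D) ℤ.* + 1
        ℤ.+ + 1 ℤ.* (D ℤ.* (S ℤ.+ T))) ℤ.* ((S ℤ.+ T) ℤ.* D)
      ≡ ((S ℤ.+ T) ℤ.* (S ℤ.+ T) ℤ.+ D ℤ.* T) ℤ.* ((D ℤ.* (S ℤ.+ T)) ℤ.* + 1)
    polynomial-identity = solve-∀

jQuotient : (k d t : ℕ) .{{_ : NonZero k}} .{{_ : NonZero d}} → ℕ
jQuotient k d t = _/_ (k * k + d * t) (k * d) {{m*n≢0 k d}}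

toℚᵘ-[r+k/d-[kr+s]/k+1]≃[kk+dt]/kd : ∀ r s t k d .{{_ : NonZero k}} .{{_ : NonZero d}} → k ≡ s + t →
  toℚᵘ (((+ r ℚ./ 1 ℚ.+ + k ℚ./ d) ℚ.- + (k * r + s) ℚ./ k) ℚ.+ + 1 ℚ./ 1)
  ≃ ℚᵘ._/_ (+ (k * k + d * t)) (k * d) {{m*n≢0 k d}}
toℚᵘ-[r+k/d-[kr+s]/k+1]≃[kk+dt]/kd r s t k d k≡s+t = begin
  toℚᵘ (((+ r ℚ./ 1 ℚ.+ + k ℚ./ d) ℚ.- + (k * r + s) ℚ./ k) ℚ.+ + 1 ℚ./ 1)
    ≈⟨ toℚᵘ-homo-[p+q-r]+s (+ r ℚ./ 1) (+ k ℚ./ d) (+ (k * r + s) ℚ./ k) (+ 1 ℚ./ 1) ⟩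
  ((toℚᵘ (+ r ℚ./ 1) ℚᵘ.+ toℚᵘ (+ k ℚ./ d)) ℚᵘ.- toℚᵘ (+ (k * r + s) ℚ./ k)) ℚᵘ.+ toℚᵘ (+ 1 ℚ./ 1)
    ≈⟨ ℚᵘ.+-cong (ℚᵘ.+-cong (ℚᵘ.+-cong (toℚᵘ-/ (+ r) 1) (toℚᵘ-/ (+ k) d)) (ℚᵘ.-‿cong (toℚᵘ-/ _ k)))
                 (toℚᵘ-/ (+ 1) 1) ⟩
  ((+ r ℚᵘ./ 1 ℚᵘ.+ + k ℚᵘ./ d) ℚᵘ.- + (k * r + s) ℚᵘ./ k) ℚᵘ.+ 1ℚᵘ
    ≡⟨ cong (λ x → ((+ r ℚᵘ./ 1 ℚᵘ.+ + k ℚᵘ./ d) ℚᵘ.- x ℚᵘ./ k) ℚᵘ.+ 1ℚᵘ) (cong (ℤ._+ + s) (ℤ.pos-* k r)) ⟩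
  ((+ r ℚᵘ./ 1 ℚᵘ.+ + k ℚᵘ./ d) ℚᵘ.- (+ k ℤ.* + r ℤ.+ + s) ℚᵘ./ k) ℚᵘ.+ 1ℚᵘ
    ≈⟨ R+k/d-[kR+S]/k+1≃[kk+dT]/kd (+ r) (+ s) (+ t) k d (cong +_ k≡s+t) ⟩
  ℚᵘ._/_ (+ k ℤ.* + k ℤ.+ + d ℤ.* + t) (k * d) {{m*n≢0 k d}}
    ≡⟨ ℚᵘ./-cong {{m*n≢0 k d}} {{m*n≢0 k d}} (sym (cong₂ ℤ._+_ (ℤ.pos-* k k) (ℤ.pos-* d t))) refl ⟩
  ℚᵘ._/_ (+ (k * k + d * t)) (k * d) {{m*n≢0 k d}} ∎
  where open ℚᵘ.≃-Reasoning

jValue≡jQuotient : ∀ {k b l c s t d} .{{_ : NonZero k}} .{{_ : NonZero d}} →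
  b ∸ k * k ≡ d → b ^ l ∸ 1 ≡ k * prefixValue b c l + s → k ≡ s + t →
  jValue k b l c ≡ + jQuotient k d t
jValue≡jQuotient {k} {b} {l} {c} {s} {t} {d} refl bˡ∸1≡kr+s k≡s+t = begin
  jValue k b l c
    ≡⟨ cong (λ x → floor (((+ r ℚ./ 1 ℚ.+ divℚ k d) ℚ.- divℚ x k) ℚ.+ + 1 ℚ./ 1)) bˡ∸1≡kr+s ⟩
  floor (((+ r ℚ./ 1 ℚ.+ divℚ k d) ℚ.- divℚ (k * r + s) k) ℚ.+ + 1 ℚ./ 1)
    ≡⟨ cong₂ (λ x y → floor (((+ r ℚ./ 1 ℚ.+ x) ℚ.- y) ℚ.+ + 1 ℚ./ 1)) (divℚ≡/ k d) (divℚ≡/ (k * r + s) k) ⟩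
  floor (((+ r ℚ./ 1 ℚ.+ + k ℚ./ d) ℚ.- + (k * r + s) ℚ./ k) ℚ.+ + 1 ℚ./ 1)
    ≡⟨ floor-≃-/ _ (k * k + d * t) (k * d) {{m*n≢0 k d}} (toℚᵘ-[r+k/d-[kr+s]/k+1]≃[kk+dt]/kd r s t k d k≡s+t) ⟩
  + jQuotient k d t ∎
  where
  open ≡-Reasoning
  r = prefixValue b c l

[k+1]*[k*d]≡k*k*d+d*k : ∀ k d → (k + 1) * (k * d) ≡ k * k * d + d * k
[k+1]*[k*d]≡k*k*d+d*k = solve-ℕ

1≤jQuotient : ∀ {k d t} .{{_ : NonZero k}} .{{_ : NonZero d}} → d ≤ k → 1 ≤ jQuotient k d t
1≤jQuotient {k} {d} {t} d≤k =
  m≥n⇒m/n>0 {{m*n≢0 k d}} (≤-trans (*-monoʳ-≤ k d≤k) (m≤m+n (k * k) (d * t)))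

jQuotient≤k+1 : ∀ {k d t} .{{_ : NonZero k}} .{{_ : NonZero d}} → t ≤ k → jQuotient k d t ≤ k + 1
jQuotient≤k+1 {k} {d} {t} t≤k = begin
  (k * k + d * t) / (k * d)           ≤⟨ /-monoˡ-≤ (k * d) (+-mono-≤ (m≤m*n (k * k) d) (*-monoʳ-≤ d t≤k)) ⟩
  (k * k * d + d * k) / (k * d)       ≡⟨ /-congˡ {o = k * d} ([k+1]*[k*d]≡k*k*d+d*k k d) ⟨
  (k + 1) * (k * d) / (k * d)         ≡⟨ m*n/n≡m (k + 1) (k * d) ⟩
  k + 1                               ∎
  where
  open ≤-Reasoning
  instance _ = m*n≢0 k d

jQuotient<k+1 : ∀ {k d t} .{{_ : NonZero k}} .{{_ : NonZero d}} → 1 < d → t ≤ k → jQuotient k d t < k + 1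
jQuotient<k+1 {k} {d} {t} 1<d t≤k = m<n*o⇒m/o<n (begin-strict
  k * k + d * t                       ≤⟨ +-monoʳ-≤ (k * k) (*-monoʳ-≤ d t≤k) ⟩
  k * k + d * k                       <⟨ +-monoˡ-< (d * k) (m<m*n (k * k) d 1<d) ⟩
  k * k * d + d * k                   ≡⟨ [k+1]*[k*d]≡k*k*d+d*k k d ⟨
  (k + 1) * (k * d)                   ∎)
  where
  open ≤-Reasoning
  instance
    _ = m*n≢0 k d
    _ = m*n≢0 k k

jQuotient≡k+1⇒d≡1 : ∀ {k d t} .{{_ : NonZero k}} .{{_ : NonZero d}} → t ≤ k → jQuotient k d t ≡ k + 1 → d ≡ 1
jQuotient≡k+1⇒d≡1 {d = d} t≤k j≡k+1 =
  ≤-antisym (≮⇒≥ (λ 1<d → <-irrefl j≡k+1 (jQuotient<k+1 1<d t≤k))) (>-nonZero⁻¹ d)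

d≡1∧t≡k⇒jQuotient≡k+1 : ∀ {k d t} .{{_ : NonZero k}} .{{_ : NonZero d}} → d ≡ 1 → t ≡ k → jQuotient k d t ≡ k + 1
d≡1∧t≡k⇒jQuotient≡k+1 {k} refl refl = begin
  (k * k + 1 * k) / (k * 1)           ≡⟨ /-congˡ {o = k * 1} (k*k+1*k≡[k+1]*[k*1] k) ⟩
  (k + 1) * (k * 1) / (k * 1)         ≡⟨ m*n/n≡m (k + 1) (k * 1) ⟩
  k + 1                               ∎
  where
  open ≡-Reasoning
  instance _ = m*n≢0 k 1
  k*k+1*k≡[k+1]*[k*1] : ∀ k → k * k + 1 * k ≡ (k + 1) * (k * 1)
  k*k+1*k≡[k+1]*[k*1] = solve-ℕ

∣m⇒∣[1+m]^n∸1 : ∀ {d m} → d ∣ m → ∀ n → d ∣ (1 + m) ^ n ∸ 1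
∣m⇒∣[1+m]^n∸1 d∣m zero    = _ ∣0
∣m⇒∣[1+m]^n∸1 {d} {m} d∣m (suc n) =
  subst (d ∣_) (sym (+-∸-comm (m * (1 + m) ^ n) (m^n>0 (1 + m) n)))
        (∣m∣n⇒∣m+n (∣m⇒∣[1+m]^n∸1 d∣m n) (∣m⇒∣m*n ((1 + m) ^ n) d∣m))

∣∧<⇒≡0 : ∀ {m n} → m ∣ n → n < m → n ≡ 0
∣∧<⇒≡0 {n = zero}  _   _   = refl
∣∧<⇒≡0 {n = suc _} m∣n n<m = contradiction m∣n (>⇒∤ n<m)

[1+km]^n∸1≡kr+s⇒s≡0 : ∀ {k m n r s} → (1 + k * m) ^ n ∸ 1 ≡ k * r + s → s < k → s ≡ 0
[1+km]^n∸1≡kr+s⇒s≡0 {k} {m} {n} {r} eq s<k =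
  ∣∧<⇒≡0 (∣m+n∣m⇒∣n (subst (k ∣_) eq (∣m⇒∣[1+m]^n∸1 (m∣m*n m) n)) (m∣m*n r)) s<k

k*r<n≤k*r+k⇒n∸1≡k*r+s : ∀ {k r n} → k * r < n → n ≤ k * r + k → ∃[ s ] (n ∸ 1 ≡ k * r + s × s < k)
k*r<n≤k*r+k⇒n∸1≡k*r+s {k} {r} {n} kr<n n≤kr+k with m≤n⇒∃[o]m+o≡n kr<n
... | s , 1+kr+s≡n = s , cong (_∸ 1) (sym 1+kr+s≡n) , +-cancelˡ-≤ (k * r) (suc s) k (begin
  k * r + suc s   ≡⟨ +-suc (k * r) s ⟩
  suc (k * r) + s ≡⟨ 1+kr+s≡n ⟩
  n               ≤⟨ n≤kr+k ⟩
  k * r + k       ∎)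
  where open ≤-Reasoning

lemma3p3 : (k b : ℕ) → 2 ≤ k → k * k < b → b ≤ k * k + k →
    (c : ℕ → ℕ) → IsNonTermExpansion b k c →
    (l : ℕ) → 1 ≤ l → PurelyPeriodicFrom l c →
    ((+ 1 ≤ℤ jValue k b l c) × (jValue k b l c ≤ℤ + (k + 1))) ×
    ((jValue k b l c ≡ + (k + 1)) ⇔ (b ≡ k * k + 1))
lemma3p3 k b 2≤k kk<b b≤kk+k c (_ , expansion) l _ _
  with k*r<n≤k*r+k⇒n∸1≡k*r+s (proj₁ (expansion l)) (proj₂ (expansion l))
... | s , bˡ∸1≡kr+s , s<k =
  subst Conclusion (sym (jValue≡jQuotient {k} {b} {l} {c} refl bˡ∸1≡kr+s k≡s+t))
    ((ℤ.+≤+ (1≤jQuotient d≤k) , ℤ.+≤+ (jQuotient≤k+1 t≤k)) , mk⇔ j≡k+1⇒b≡kk+1 b≡kk+1⇒j≡k+1)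
  where
  Conclusion : ℤ → Set
  Conclusion j = ((+ 1 ≤ℤ j) × (j ≤ℤ + (k + 1))) × ((j ≡ + (k + 1)) ⇔ (b ≡ k * k + 1))

  d = b ∸ k * k
  t = k ∸ s
  instance
    _ : NonZero k
    _ = >-nonZero (≤-trans (s≤s z≤n) 2≤k)
    _ : NonZero d
    _ = >-nonZero (m<n⇒0<n∸m kk<b)

  d≤k : d ≤ k
  d≤k = m≤n+o⇒m∸n≤o b (k * k) b≤kk+k
  k≡s+t : k ≡ s + t
  k≡s+t = sym (m+[n∸m]≡n (<⇒≤ s<k))
  t≤k : t ≤ k
  t≤k = m∸n≤m k s

  j≡k+1⇒b≡kk+1 : + jQuotient k d t ≡ + (k + 1) → b ≡ k * k + 1
  j≡k+1⇒b≡kk+1 j≡k+1 = trans (sym (m+[n∸m]≡n (<⇒≤ kk<b)))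
                              (cong (_+_ (k * k)) (jQuotient≡k+1⇒d≡1 t≤k (ℤ.+-injective j≡k+1)))

  b≡kk+1⇒j≡k+1 : b ≡ k * k + 1 → + jQuotient k d t ≡ + (k + 1)
  b≡kk+1⇒j≡k+1 b≡kk+1 = cong +_ (d≡1∧t≡k⇒jQuotient≡k+1 d≡1 (sym (trans k≡s+t (cong (_+ t) s≡0))))
    where
    d≡1 : d ≡ 1
    d≡1 = trans (cong (_∸ k * k) b≡kk+1) (m+n∸m≡n (k * k) 1)
    s≡0 : s ≡ 0
    s≡0 = [1+km]^n∸1≡kr+s⇒s≡0 {m = k} {n = l}
            (subst (λ x → x ^ l ∸ 1 ≡ k * prefixValue b c l + s) (trans b≡kk+1 (+-comm (k * k) 1)) bˡ∸1≡kr+s) s<k
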